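{- For any $G_{7,2}$-critical graph $G$, the graph $G\ast P_4$ is $C_7$-critical.
   Context: $G_{7,2}$ is the graph on $\{0,\dots,6\}$ with $ij$ an edge iff $2\le|i-j|\le5$; $C_7$ is the $7$-cycle. A graph is $X$-critical if it has no homomorphism to $X$ but every proper subgraph does. $G\ast P_4$ is obtained from $G$ by replacing every edge $uv$ with a path on $4$ vertices $u,a,b,v$ with two new internal vertices $a,b$ (distinct for each edge). -}

module Defs where

open import Level using (0ℓ)
open import Data.Nat using (ℕ; _≤_; ∣_-_∣)
open import Data.Nat.Properties using (∣-∣-comm; ∣n-n∣≡0)
open import Data.Fin using (Fin; zero; suc; toℕ; _<_)
open import Data.Bool using (Bool; true; false)
open import Data.Product using (Σ; Σ-syntax; _×_; _,_; proj₁; proj₂)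
open import Data.Sum using (_⊎_; inj₁; inj₂)
open import Data.Empty using (⊥)
open import Relation.Nullary using (¬_)
open import Relation.Binary.PropositionalEquality using (_≡_; refl; subst; sym; trans)

record Graph : Set₁ where
  field
    V    : Set
    E    : V → V → Set
    Esym : ∀ {u v} → E u v → E v u
    Eirr : ∀ {v} → ¬ E v v
open Graph public

Hom : Graph → Graph → Set
Hom G H = Σ[ f ∈ (V G → V H) ] (∀ {u v} → E G u v → E H (f u) (f v))

record Subgraph (G : Graph) : Set₁ where
  field
    VS    : V G → Set
    ES    : V G → V G → Set
    ES⊆E  : ∀ {u v} → ES u v → E G u v
    ESsym : ∀ {u v} → ES u v → ES v u
    ESˡ   : ∀ {u v} → ES u v → VS u
    ESʳ   : ∀ {u v} → ES u v → VS v
open Subgraph public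

asGraph : {G : Graph} → Subgraph G → Graph
asGraph {G} S = record
  { V    = Σ (V G) (VS S)
  ; E    = λ x y → ES S (proj₁ x) (proj₁ y)
  ; Esym = ESsym S
  ; Eirr = λ e → Eirr G (ES⊆E S e)
  }

Proper : {G : Graph} → Subgraph G → Set
Proper {G} S = (Σ[ v ∈ V G ] ¬ VS S v)
             ⊎ (Σ[ u ∈ V G ] Σ[ v ∈ V G ] (E G u v × ¬ ES S u v))

Critical : Graph → Graph → Set₁
Critical X G = (¬ Hom G X) × ((S : Subgraph G) → Proper S → Hom (asGraph S) X)

record FinGraph (n : ℕ) : Set where
  field
    adj    : Fin n → Fin n → Bool
    adjSym : ∀ u v → adj u v ≡ adj v u
    adjIrr : ∀ v → adj v v ≡ false
open FinGraph public

toGraph : ∀ {n} → FinGraph n → Graph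
toGraph {n} G = record
  { V    = Fin n
  ; E    = λ u v → adj G u v ≡ true
  ; Esym = λ {u} {v} e → trans (sym (adjSym G u v)) e
  ; Eirr = λ {v} e → f (trans (sym (adjIrr G v)) e)
  }
  where
    f : false ≡ true → ⊥
    f ()

dist : Fin 7 → Fin 7 → ℕ
dist i j = ∣ toℕ i - toℕ j ∣

G72 : Graph
G72 = record
  { V    = Fin 7
  ; E    = λ i j → (2 ≤ dist i j) × (dist i j ≤ 5)
  ; Esym = λ {i} {j} (a , b) →
      subst (λ d → (2 ≤ d) × (d ≤ 5)) (∣-∣-comm (toℕ i) (toℕ j)) (a , b)
  ; Eirr = λ {i} (a , b) → irr i a
  }
  where
    irr : ∀ i → ¬ (2 ≤ dist i i)
    irr i p with subst (2 ≤_) (∣n-n∣≡0 (toℕ i)) p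
    ... | ()

-- C_7: ij an edge iff i - j ≡ ±1 (mod 7), i.e. |i - j| ∈ {1, 6}.
C7 : Graph
C7 = record
  { V    = Fin 7
  ; E    = λ i j → (dist i j ≡ 1) ⊎ (dist i j ≡ 6)
  ; Esym = λ {i} {j} e →
      subst (λ d → (d ≡ 1) ⊎ (d ≡ 6)) (∣-∣-comm (toℕ i) (toℕ j)) e
  ; Eirr = λ {i} e → irr i e
  }
  where
    irr : ∀ i → ¬ ((dist i i ≡ 1) ⊎ (dist i i ≡ 6))
    irr i e with dist i i | ∣n-n∣≡0 (toℕ i)
    irr i (inj₁ ()) | .0 | refl
    irr i (inj₂ ()) | .0 | refl

-- G ∗ P₄: each edge uv (taken once, oriented with u < v) is replaced by
-- a path u, a, b, v with two new internal vertices a = (e,0), b = (e,1).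

Edge : ∀ {n} → FinGraph n → Set
Edge {n} G = Σ[ u ∈ Fin n ] Σ[ v ∈ Fin n ] ((u < v) × (adj G u v ≡ true))

src tgt : ∀ {n} {G : FinGraph n} → Edge G → Fin n
src (u , _ , _) = u
tgt (_ , v , _) = v

SubdV : ∀ {n} → FinGraph n → Set
SubdV {n} G = Fin n ⊎ (Edge G × Fin 2)

data Step {n} (G : FinGraph n) : SubdV G → SubdV G → Set where
  s₀ : (e : Edge G) → Step G (inj₁ (src {G = G} e)) (inj₂ (e , zero))
  s₁ : (e : Edge G) → Step G (inj₂ (e , zero)) (inj₂ (e , suc zero))
  s₂ : (e : Edge G) → Step G (inj₂ (e , suc zero)) (inj₁ (tgt {G = G} e))

stepIrr : ∀ {n} {G : FinGraph n} {x} → ¬ Step G x x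
stepIrr ()

_∗P₄ : ∀ {n} → FinGraph n → Graph
G ∗P₄ = record
  { V    = SubdV G
  ; E    = λ x y → Step G x y ⊎ Step G y x
  ; Esym = λ { (inj₁ s) → inj₂ s ; (inj₂ s) → inj₁ s }
  ; Eirr = λ { (inj₁ s) → stepIrr s ; (inj₂ s) → stepIrr s }
  }

-- Let X, Y be graphs such that, for maps α : Y → X and β : X → Y, every walk of
-- length three in Y from p to q gives an edge α p α q of X, every edge p q of X
-- gives such a walk from β p to β q, and Y has no isolated vertex.  Then G ∗ P₄
-- is Y-critical whenever G is X-critical.  A map G ∗ P₄ → Y composed with α
-- maps G to X.  If a step of the path replacing the edge e₀ is missing, map
-- G - e₀ to X, compose with β, colour the paths of all other edges by the walks,
-- and colour the two remaining steps of the path of e₀ greedily.  For X = G_{7,2}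
-- and Y = C₇ take α x = 3x and β x = 5x modulo 7: a walk of length three in C₇
-- changes x by ±1 or ±3, while an edge of G_{7,2} changes x by ±2 or ±3.
module Submission where

open import Defs
open import Data.Nat as ℕ using (ℕ; _*_; _≤?_)
open import Data.Nat.DivMod using (_mod_)
open import Data.Fin using (Fin; zero; suc; toℕ)
open import Data.Fin.Properties using (_≟_; all?; any?; <-cmp; <-irrelevant; <-asym)
open import Data.Bool using (true)
import Data.Bool.Properties as Bool
open import Data.Product using (Σ-syntax; ∃; _×_; _,_; proj₁; proj₂)
open import Data.Sum using (_⊎_; inj₁; inj₂)
open import Data.Unit using (⊤)
open import Data.Empty using (⊥-elim)
open import Function using (_∘_)
open import Relation.Nullary using (Dec; yes; no; ¬_)
open import Relation.Nullary.Decidable using (_×-dec_; _⊎-dec_; _→-dec_; from-yes)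
open import Relation.Binary.Definitions using (DecidableEquality; tri<; tri≈; tri>)
open import Relation.Binary.PropositionalEquality
  using (_≡_; _≢_; refl; sym; cong; cong₂; subst; subst₂)
open import Axiom.UniquenessOfIdentityProofs using (module Decidable⇒UIP)

StepFits : (X : Graph) → V X → V X × V X → V X → Fin 3 → Set
StepFits X p (c₀ , c₁) q zero             = E X p c₀
StepFits X p (c₀ , c₁) q (suc zero)       = E X c₀ c₁
StepFits X p (c₀ , c₁) q (suc (suc zero)) = E X c₁ q

Walk₃ : (X : Graph) → V X → V X → Set
Walk₃ X p q = Σ[ c ∈ V X × V X ] (∀ i → StepFits X p c q i)

Walk₃Except : (X : Graph) → Fin 3 → V X → V X → Set
Walk₃Except X k p q = Σ[ c ∈ V X × V X ] (∀ i → i ≢ k → StepFits X p c q i)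

NoIsolated : Graph → Set
NoIsolated X = ∀ x → Σ[ y ∈ V X ] E X x y

walk₃-except : ∀ {X} → NoIsolated X → ∀ k p q → Walk₃Except X k p q
walk₃-except {X} nbr zero p q = (proj₁ (nbr c₁) , c₁) , λ where
    zero             ≢k → ⊥-elim (≢k refl)
    (suc zero)       _  → Esym X (proj₂ (nbr c₁))
    (suc (suc zero)) _  → Esym X (proj₂ (nbr q))
  where c₁ = proj₁ (nbr q)
walk₃-except {X} nbr (suc zero) p q = (proj₁ (nbr p) , proj₁ (nbr q)) , λ where
    zero             _  → proj₂ (nbr p)
    (suc zero)       ≢k → ⊥-elim (≢k refl)
    (suc (suc zero)) _  → Esym X (proj₂ (nbr q))
walk₃-except {X} nbr (suc (suc zero)) p q = (c₀ , proj₁ (nbr c₀)) , λ where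
    zero             _  → proj₂ (nbr p)
    (suc zero)       _  → proj₂ (nbr c₀)
    (suc (suc zero)) ≢k → ⊥-elim (≢k refl)
  where c₀ = proj₁ (nbr p)

module Subdivision {n : ℕ} (G : FinGraph n) where

  source target : Edge G → Fin n
  source = src {G = G}
  target = tgt {G = G}

  edge-unique : ∀ {e e′} → source e ≡ source e′ → target e ≡ target e′ → e ≡ e′
  edge-unique {u , v , u<v , uv} {.u , .v , u<v′ , uv′} refl refl =
    cong₂ (λ l a → u , v , l , a)
          (<-irrelevant u<v u<v′) (Decidable⇒UIP.≡-irrelevant Bool._≟_ uv uv′)

  Edge-≟ : DecidableEquality (Edge G)
  Edge-≟ e e′ with source e ≟ source e′ | target e ≟ target e′
  ... | yes p | yes q = yes (edge-unique p q)
  ... | no ¬p | _     = no (¬p ∘ cong source)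
  ... | _     | no ¬q = no (¬q ∘ cong target)

  Joins : Edge G → Fin n → Fin n → Set
  Joins e a b = (a ≡ source e × b ≡ target e) ⊎ (a ≡ target e × b ≡ source e)

  edge-between : ∀ {u v} → adj G u v ≡ true → Σ[ e ∈ Edge G ] Joins e u v
  edge-between {u} {v} uv with <-cmp u v
  ... | tri< u<v _ _ = (u , v , u<v , uv) , inj₁ (refl , refl)
  ... | tri≈ _ refl _ = ⊥-elim (Eirr (toGraph G) {u} uv)
  ... | tri> _ _ v<u = (v , u , v<u , Esym (toGraph G) {u} {v} uv) , inj₂ (refl , refl)

  hom-from-edges : ∀ {X} (f : Fin n → V X) →
                   (∀ e → E X (f (source e)) (f (target e))) → Hom (toGraph G) X
  hom-from-edges {X} f f-edge = f , λ uv → along (edge-between uv)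
    where
      along : ∀ {u v} → Σ[ e ∈ Edge G ] Joins e u v → E X (f u) (f v)
      along (e , inj₁ (refl , refl)) = f-edge e
      along (e , inj₂ (refl , refl)) = Esym X (f-edge e)

  deleteEdge : Edge G → Subgraph (toGraph G)
  deleteEdge e₀ = record
    { VS    = λ _ → ⊤
    ; ES    = λ a b → (adj G a b ≡ true) × ¬ Joins e₀ a b
    ; ES⊆E  = proj₁
    ; ESsym = λ {a} {b} (ab , ¬j) → Esym (toGraph G) {a} {b} ab , ¬j ∘ swap
    ; ESˡ   = _
    ; ESʳ   = _
    }
    where
      swap : ∀ {a b} → Joins e₀ b a → Joins e₀ a b
      swap (inj₁ (p , q)) = inj₂ (q , p)
      swap (inj₂ (p , q)) = inj₁ (q , p)

  -- Edges are oriented from the smaller to the larger endpoint, so Joins e₀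
  -- holds for the endpoints of e ≢ e₀ in neither order.
  hom-avoiding : ∀ {X} → Critical X (toGraph G) → (e₀ : Edge G) →
                 Σ[ f ∈ (Fin n → V X) ] (∀ e → e ≢ e₀ → E X (f (source e)) (f (target e)))
  hom-avoiding crit e₀ = (λ a → proj₁ ψ (a , _)) , λ e e≢e₀ →
      proj₂ ψ (proj₂ (proj₂ (proj₂ e)) , not-joins e e≢e₀)
    where
      ψ = proj₂ crit (deleteEdge e₀)
            (inj₂ (source e₀ , target e₀ , proj₂ (proj₂ (proj₂ e₀)) ,
                   λ (_ , ¬j) → ¬j (inj₁ (refl , refl))))
      not-joins : ∀ e → e ≢ e₀ → ¬ Joins e₀ (source e) (target e)
      not-joins e e≢e₀ (inj₁ (p , q)) = e≢e₀ (edge-unique p q)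
      not-joins (_ , _ , u<v , _) _ (inj₂ (refl , refl)) = <-asym u<v (proj₁ (proj₂ (proj₂ e₀)))

  isolated-hom : ∀ {X} {w} → V X → Critical X (toGraph G) →
                 ¬ (∃ λ w′ → adj G w w′ ≡ true) → Hom (toGraph G) X
  isolated-hom {X} {w} x₀ crit isolated = f , f-edge
    where
      G-w : Subgraph (toGraph G)
      G-w = record
        { VS    = λ z → z ≢ w
        ; ES    = λ a b → adj G a b ≡ true
        ; ES⊆E  = λ ab → ab
        ; ESsym = λ {a} {b} ab → Esym (toGraph G) {a} {b} ab
        ; ESˡ   = λ {a} {b} ab a≡w → isolated (b , subst (λ z → adj G z b ≡ true) a≡w ab)
        ; ESʳ   = λ {a} {b} ab b≡w →
                    isolated (a , subst (λ z → adj G z a ≡ true) b≡w (Esym (toGraph G) {a} {b} ab))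
        }
      ψ = proj₂ crit G-w (inj₁ (w , λ w≢w → w≢w refl))
      f : Fin n → V X
      f z with z ≟ w
      ... | yes _  = x₀
      ... | no z≢w = proj₁ ψ (z , z≢w)
      f-edge : ∀ {u v} → adj G u v ≡ true → E X (f u) (f v)
      f-edge {u} {v} uv with u ≟ w | v ≟ w
      ... | yes u≡w | _       = ⊥-elim (ESˡ G-w {u} {v} uv u≡w)
      ... | no _    | yes v≡w = ⊥-elim (ESʳ G-w {u} {v} uv v≡w)
      ... | no _    | no _    = proj₂ ψ uv

  incident-edge : ∀ {X} → V X → Critical X (toGraph G) →
                  ∀ w → Σ[ e ∈ Edge G ] (source e ≡ w ⊎ target e ≡ w)
  incident-edge {X} x₀ crit w with any? (λ w′ → adj G w w′ Bool.≟ true)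
  ... | no isolated = ⊥-elim (proj₁ crit (isolated-hom {X} x₀ crit isolated))
  ... | yes (_ , ww′) with edge-between ww′
  ...   | e , inj₁ (p , _) = e , inj₁ (sym p)
  ...   | e , inj₂ (q , _) = e , inj₂ (sym q)

  stepEdge : ∀ {x y} → Step G x y → Edge G
  stepEdge (s₀ e) = e
  stepEdge (s₁ e) = e
  stepEdge (s₂ e) = e

  stepIndex : ∀ {x y} → Step G x y → Fin 3
  stepIndex (s₀ _) = zero
  stepIndex (s₁ _) = suc zero
  stepIndex (s₂ _) = suc (suc zero)

  step-injective : ∀ {x y x′ y′} (s : Step G x y) (s′ : Step G x′ y′) →
                   stepEdge s ≡ stepEdge s′ → stepIndex s ≡ stepIndex s′ → x ≡ x′ × y ≡ y′
  step-injective (s₀ _) (s₀ _) refl _ = refl , refl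
  step-injective (s₁ _) (s₁ _) refl _ = refl , refl
  step-injective (s₂ _) (s₂ _) refl _ = refl , refl

  colour : ∀ {X} → (Fin n → V X) → (Edge G → V X × V X) → SubdV G → V X
  colour φ c (inj₁ u)             = φ u
  colour φ c (inj₂ (e , zero))    = proj₁ (c e)
  colour φ c (inj₂ (e , suc zero)) = proj₂ (c e)

  colour-step : ∀ {X} (φ : Fin n → V X) (c : Edge G → V X × V X) {x y} (s : Step G x y) →
                let e = stepEdge s in
                StepFits X (φ (source e)) (c e) (φ (target e)) (stepIndex s) →
                E X (colour {X} φ c x) (colour {X} φ c y)
  colour-step φ c (s₀ e) fits = fits
  colour-step φ c (s₁ e) fits = fits
  colour-step φ c (s₂ e) fits = fits

  walk-of-hom : ∀ {X} (h : Hom (G ∗P₄) X) (e : Edge G) →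
                Walk₃ X (proj₁ h (inj₁ (source e))) (proj₁ h (inj₁ (target e)))
  walk-of-hom (h , h-edge) e = (h (inj₂ (e , zero)) , h (inj₂ (e , suc zero))) , λ where
    zero             → h-edge (inj₁ (s₀ e))
    (suc zero)       → h-edge (inj₁ (s₁ e))
    (suc (suc zero)) → h-edge (inj₁ (s₂ e))

  hom-from-steps : ∀ {X} (S : Subgraph (G ∗P₄)) (g : SubdV G → V X) →
                   (∀ {x y} → Step G x y → ES S x y → E X (g x) (g y)) → Hom (asGraph S) X
  hom-from-steps {X} S g g-step = g ∘ proj₁ , λ xy → along (ES⊆E S xy) xy
    where
      along : ∀ {x y} → E (G ∗P₄) x y → ES S x y → E X (g x) (g y)
      along (inj₁ s) xy = g-step s xy
      along (inj₂ s) xy = Esym X (g-step s (ESsym S xy))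

  MissingStep : Subgraph (G ∗P₄) → Set
  MissingStep S = Σ[ x ∈ SubdV G ] Σ[ y ∈ SubdV G ] (Step G x y × ¬ ES S x y)

  proper⇒missing-step : (∀ w → Σ[ e ∈ Edge G ] (source e ≡ w ⊎ target e ≡ w)) →
                        (S : Subgraph (G ∗P₄)) → Proper S → MissingStep S
  proper⇒missing-step incident S (inj₁ (inj₁ w , ¬w)) with incident w
  ... | e , inj₁ refl = _ , _ , s₀ e , ¬w ∘ ESˡ S
  ... | e , inj₂ refl = _ , _ , s₂ e , ¬w ∘ ESʳ S
  proper⇒missing-step _ S (inj₁ (inj₂ (e , zero) , ¬x))     = _ , _ , s₁ e , ¬x ∘ ESˡ S
  proper⇒missing-step _ S (inj₁ (inj₂ (e , suc zero) , ¬x)) = _ , _ , s₁ e , ¬x ∘ ESʳ S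
  proper⇒missing-step _ S (inj₂ (x , y , inj₁ s , ¬xy)) = x , y , s , ¬xy
  proper⇒missing-step _ S (inj₂ (x , y , inj₂ s , ¬xy)) = y , x , s , ¬xy ∘ ESsym S

module _ (X Y : Graph) (α : V Y → V X) (β : V X → V Y)
         (walk⇒edge : ∀ p q → Walk₃ Y p q → E X (α p) (α q))
         (edge⇒walk : ∀ p q → E X p q → Walk₃ Y (β p) (β q))
         (x₀ : V X) (no-isolated : NoIsolated Y)
         {n : ℕ} (G : FinGraph n) (crit : Critical X (toGraph G)) where

  open Subdivision G

  ∗P₄-no-hom : ¬ Hom (G ∗P₄) Y
  ∗P₄-no-hom h =
    proj₁ crit (hom-from-edges {X} (α ∘ proj₁ h ∘ inj₁) λ e → walk⇒edge _ _ (walk-of-hom h e))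

  missing-step⇒hom : (S : Subgraph (G ∗P₄)) → MissingStep S → Hom (asGraph S) Y
  missing-step⇒hom S (x* , y* , s* , ¬x*y*) =
      hom-from-steps {Y} S (colour {Y} φ c) λ s xy → colour-step {Y} φ c s (fits s xy)
    where
      e* = stepEdge s*
      k  = stepIndex s*
      avoiding = hom-avoiding {X} crit e*
      f  = proj₁ avoiding
      φ  = β ∘ f
      path : (e : Edge G) → Σ[ c ∈ V Y × V Y ]
             (∀ i → (e ≡ e* → i ≢ k) → StepFits Y (φ (source e)) c (φ (target e)) i)
      path e with Edge-≟ e e*
      ... | yes refl = let (c , fits) = walk₃-except no-isolated k _ _ in
                       c , λ i ≢k → fits i (≢k refl)
      ... | no e≢e*  = let (c , fits) = edge⇒walk _ _ (proj₂ avoiding e e≢e*) in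
                       c , λ i _ → fits i
      c = proj₁ ∘ path
      fits : ∀ {x y} (s : Step G x y) → ES S x y →
             StepFits Y (φ (source (stepEdge s))) (c (stepEdge s)) (φ (target (stepEdge s))) (stepIndex s)
      fits s xy = proj₂ (path (stepEdge s)) (stepIndex s) λ e≡e* i≡k →
        let (x≡x* , y≡y*) = step-injective s s* e≡e* i≡k in ¬x*y* (subst₂ (ES S) x≡x* y≡y* xy)

  ∗P₄-critical : Critical Y (G ∗P₄)
  ∗P₄-critical = ∗P₄-no-hom , λ S →
    missing-step⇒hom S ∘ proper⇒missing-step (incident-edge {X} x₀ crit) S

scale : ℕ → Fin 7 → Fin 7
scale m x = (m * toℕ x) mod 7

C7? : ∀ x y → Dec (E C7 x y)
C7? x y = (dist x y ℕ.≟ 1) ⊎-dec (dist x y ℕ.≟ 6)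

G72? : ∀ x y → Dec (E G72 x y)
G72? x y = (2 ≤? dist x y) ×-dec (dist x y ≤? 5)

stepFits? : ∀ p c q i → Dec (StepFits C7 p c q i)
stepFits? p (c₀ , c₁) q zero             = C7? p c₀
stepFits? p (c₀ , c₁) q (suc zero)       = C7? c₀ c₁
stepFits? p (c₀ , c₁) q (suc (suc zero)) = C7? c₁ q

C7-walk₃⇒G72 : ∀ p q → Walk₃ C7 p q → E G72 (scale 3 p) (scale 3 q)
C7-walk₃⇒G72 p q ((c₀ , c₁) , fits) = check p c₀ c₁ q fits
  where
    check : ∀ p c₀ c₁ q → (∀ i → StepFits C7 p (c₀ , c₁) q i) → E G72 (scale 3 p) (scale 3 q)
    check = from-yes (all? λ p → all? λ c₀ → all? λ c₁ → all? λ q →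
              all? (stepFits? p (c₀ , c₁) q) →-dec G72? (scale 3 p) (scale 3 q))

G72⇒C7-walk₃ : ∀ p q → E G72 p q → Walk₃ C7 (scale 5 p) (scale 5 q)
G72⇒C7-walk₃ p q pq = let (c₀ , c₁ , fits) = search p q pq in (c₀ , c₁) , fits
  where
    search : ∀ p q → E G72 p q →
             ∃ λ c₀ → ∃ λ c₁ → ∀ i → StepFits C7 (scale 5 p) (c₀ , c₁) (scale 5 q) i
    search = from-yes (all? λ p → all? λ q → G72? p q →-dec
               any? λ c₀ → any? λ c₁ → all? (stepFits? (scale 5 p) (c₀ , c₁) (scale 5 q)))

C7-no-isolated : NoIsolated C7
C7-no-isolated = from-yes (all? λ x → any? (C7? x))

corollary3p7 : (n : ℕ) (G : FinGraph n) → Critical G72 (toGraph G) → Critical C7 (G ∗P₄)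
corollary3p7 n =
  ∗P₄-critical G72 C7 (scale 3) (scale 5) C7-walk₃⇒G72 G72⇒C7-walk₃ zero C7-no-isolated
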